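{- Let $F$ be a 2-CNF formula with $m$ clauses containing no semicomplete sub-multiset of clauses. For each subset $R=\{x_1,\dots,x_q\}\subseteq\mathrm{var}(F)$ we have $\mathrm{sat}(F)\ge (3m+k_R)/4$, where \[ k_R=\sum_{1\le i\le q}\big(c(x_i)-c(\overline{x_i})\big)+\sum_{1\le i<j\le q}\big(c(x_i\overline{x_j})+c(\overline{x_i}x_j)-c(x_ix_j)-c(\overline{x_i}\,\overline{x_j})\big). \]
   Context: A literal is a variable $x$ or its negation $\overline{x}$. A clause is a finite set of literals with no complementary pair; a 2-CNF formula is a finite multiset of clauses each with exactly 2 literals; clause $\{p,q\}$ is written $pq$. $\mathrm{var}(F)$ is the set of variables occurring in $F$. A truth assignment with values in $\{ -1,1\}$ satisfies a clause if some positive literal $x$ in it has value $1$ or some negative literal $\overline{x}$ in it has $x$ of value $-1$; $\mathrm{sat}(F)$ is the maximum over truth assignments of $\mathrm{var}(F)$ of the number of satisfied clauses (with multiplicity). For a literal $p$, $c(p)$ is the number of clauses of $F$ containing $p$; for literals $p,q$ with $p\ne\overline{q}$, $c(pq)$ is the number of occurrences of the clause $pq$ in $F$. Two distinct clauses $Y,Z$ have a conflict if some $p\in Y$ has $\overline{p}\in Z$; a 2-CNF formula is semicomplete if it has exactly 4 clauses and every pair of distinct clauses has a conflict. -}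

module Defs where

open import Data.Nat using (ℕ; zero; suc; _≡ᵇ_; _<_)
open import Data.Bool using (Bool; true; false; _∧_; _∨_; not; if_then_else_)
open import Data.Integer using (ℤ; +_; _-_) renaming (_+_ to _+ℤ_)
open import Data.List using (List; []; _∷_; length; lookup)
open import Data.List.Relation.Unary.Any using (Any)
open import Data.Fin using (Fin) renaming (_<_ to _<ᶠ_)
open import Data.Product using (Σ; _×_; ∃)
open import Data.Sum using (_⊎_)
open import Relation.Binary.PropositionalEquality using (_≡_; _≢_)
open import Relation.Nullary using (¬_)

-- A literal: variable (a natural number) with a polarity (true = positive x, false = x̄).
record Lit : Set where
  constructor lit
  field
    var : ℕ
    pos : Bool

open Lit public

neg : Lit → Lit
neg (lit x b) = lit x (not b)

_=ᵇ_ : Bool → Bool → Bool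
true  =ᵇ b = b
false =ᵇ b = not b

_≟ᴸ_ : Lit → Lit → Bool
lit x a ≟ᴸ lit y b = (x ≡ᵇ y) ∧ (a =ᵇ b)

-- A 2-clause {p, q}: exactly two literals with no complementary pair,
-- i.e. the two literals are on different variables. The order of
-- fst/snd is irrelevant (all notions below are symmetric).
record Clause : Set where
  constructor cl
  field
    fst : Lit
    snd : Lit
    distinct : var fst ≢ var snd

open Clause public

-- a 2-CNF formula is a finite multiset of clauses (a list)
Formula : Set
Formula = List Clause

_∈ᶜ_ : Lit → Clause → Set
p ∈ᶜ C = (p ≡ fst C) ⊎ (p ≡ snd C)

_∈var_ : ℕ → Formula → Set
x ∈var F = Any (λ C → (var (fst C) ≡ x) ⊎ (var (snd C) ≡ x)) F

-- truth assignments (true ↔ 1, false ↔ -1); only values on var(F) matter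
Assignment : Set
Assignment = ℕ → Bool

litVal : Assignment → Lit → Bool
litVal α (lit x true)  = α x
litVal α (lit x false) = not (α x)

satisfies : Assignment → Clause → Bool
satisfies α C = litVal α (fst C) ∨ litVal α (snd C)

numSat : Formula → Assignment → ℕ
numSat []      α = 0
numSat (C ∷ F) α = if satisfies α C then suc (numSat F α) else numSat F α

containsᵇ : Clause → Lit → Bool
containsᵇ C p = (fst C ≟ᴸ p) ∨ (snd C ≟ᴸ p)

c₁ : Formula → Lit → ℕ
c₁ []      p = 0
c₁ (C ∷ F) p = if containsᵇ C p then suc (c₁ F p) else c₁ F p

isClauseᵇ : Clause → Lit → Lit → Bool
isClauseᵇ C p q = ((fst C ≟ᴸ p) ∧ (snd C ≟ᴸ q)) ∨ ((fst C ≟ᴸ q) ∧ (snd C ≟ᴸ p))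

c₂ : Formula → Lit → Lit → ℕ
c₂ []      p q = 0
c₂ (C ∷ F) p q = if isClauseᵇ C p q then suc (c₂ F p q) else c₂ F p q

Conflict : Clause → Clause → Set
Conflict Y Z = Σ Lit (λ p → (p ∈ᶜ Y) × (neg p ∈ᶜ Z))

-- F contains a semicomplete sub-multiset: four clause occurrences
-- (distinct positions i<j<k<l in the list) pairwise in conflict
HasSemicompleteSub : Formula → Set
HasSemicompleteSub F =
  Σ (Fin (length F)) λ i → Σ (Fin (length F)) λ j →
  Σ (Fin (length F)) λ k → Σ (Fin (length F)) λ l →
  (i <ᶠ j) × (j <ᶠ k) × (k <ᶠ l) ×
  Conflict (lookup F i) (lookup F j) × Conflict (lookup F i) (lookup F k) ×
  Conflict (lookup F i) (lookup F l) × Conflict (lookup F j) (lookup F k) ×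
  Conflict (lookup F j) (lookup F l) × Conflict (lookup F k) (lookup F l)

pl nl : ℕ → Lit
pl x = lit x true
nl x = lit x false

sum₁ : Formula → List ℕ → ℤ
sum₁ F []       = + 0
sum₁ F (x ∷ xs) = ((+ c₁ F (pl x)) - (+ c₁ F (nl x))) +ℤ sum₁ F xs

pairTerm : Formula → ℕ → ℕ → ℤ
pairTerm F x y =
  ((+ c₂ F (pl x) (nl y)) +ℤ (+ c₂ F (nl x) (pl y)))
  - ((+ c₂ F (pl x) (pl y)) +ℤ (+ c₂ F (nl x) (nl y)))

sumWith : Formula → ℕ → List ℕ → ℤ
sumWith F x []       = + 0
sumWith F x (y ∷ ys) = pairTerm F x y +ℤ sumWith F x ys

sum₂ : Formula → List ℕ → ℤ
sum₂ F []       = + 0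
sum₂ F (x ∷ xs) = sumWith F x xs +ℤ sum₂ F xs

kR : Formula → List ℕ → ℤ
kR F R = sum₁ F R +ℤ sum₂ F R

module Submission where

-- The bound is proved by the method of conditional expectations; it holds
-- for every 2-CNF formula.
--
-- A partial assignment gives each variable a value +1, -1 or 0, where 0
-- means "still to be chosen uniformly at random".  If the literals of a
-- clause pq have values a and b, then 4·Pr[pq satisfied] = 3 + a + b - ab;
-- summing over F gives the score of the partial assignment.
--
--  1. The score is affine in the value of each single variable, so some
--     choice of ±1 for an unset variable does not decrease it ("fix").
--  2. Fixing the two variables of every clause in turn yields a partial
--     assignment with no 0 on var(F); its score is 4 · (number of
--     clauses satisfied by the corresponding truth assignment).
--  3. The partial assignment that is +1 on R and 0 elsewhere has score
--     exactly 3m + k_R: k_R is additive in the clauses of F, and for one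
--     clause pq it equals a + b - ab with a, b the values of p, q.
--
-- Chaining 3, 1 (iterated) and 2 gives 3m + k_R ≤ 4·sat(F).

open import Defs
open import Data.Nat using (ℕ; suc; _≡ᵇ_; _≟_) renaming (_*_ to _*ℕ_)
open import Data.Nat.Properties using (≡ᵇ⇒≡; ≡⇒≡ᵇ; *-suc)
open import Data.Bool using (Bool; true; false; _∧_; _∨_; not; if_then_else_)
open import Data.Bool.Properties using (∧-conicalˡ; ∧-conicalʳ; T-≡)
open import Function.Bundles using (Equivalence)
open import Data.Integer using (ℤ; +_; _+_; _*_; _≤_; _-_; -_)
import Data.Integer.Properties as ℤP
open import Data.Integer.Tactic.RingSolver using (solve-∀)
open import Algebra.Properties.CommutativeSemigroup ℤP.+-commutativeSemigroup
  using (interchange)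
open import Data.List using (List; []; _∷_; length)
open import Data.List.Relation.Unary.All using (All; []; _∷_)
open import Data.List.Relation.Unary.Unique.Propositional using (Unique)
open import Data.List.Relation.Unary.AllPairs using ([]; _∷_)
open import Data.Product using (∃; _×_; _,_; proj₁; proj₂)
open import Data.Empty using (⊥; ⊥-elim)
open import Relation.Nullary using (¬_; Dec; yes; no)
open import Relation.Binary.PropositionalEquality

-- Partial assignments and their score

data Val : Set where
  plus minus unset : Val

toℤ : Val → ℤ
toℤ plus  = + 1
toℤ minus = - + 1
toℤ unset = + 0

Fixed : Val → Set
Fixed t = t ≢ unset

Partial : Set
Partial = ℕ → Val

upd : Partial → ℕ → Val → Partial
upd e v t x with x ≟ v
... | yes _ = t
... | no  _ = e x

upd-here : ∀ e v t {x} → x ≡ v → upd e v t x ≡ t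
upd-here e v t {x} x≡v with x ≟ v
... | yes _   = refl
... | no  x≢v = ⊥-elim (x≢v x≡v)

upd-away : ∀ e v t {x} → x ≢ v → upd e v t x ≡ e x
upd-away e v t {x} x≢v with x ≟ v
... | yes x≡v = ⊥-elim (x≢v x≡v)
... | no  _   = refl

upd-self : ∀ e v x → upd e v (e v) x ≡ e x
upd-self e v x with x ≟ v
... | yes refl = refl
... | no  _    = refl

upd-keeps-fixed : ∀ e v t x → Fixed t → Fixed (e x) → Fixed (upd e v t x)
upd-keeps-fixed e v t x fixed-t fixed-ex with x ≟ v
... | yes _ = fixed-t
... | no  _ = fixed-ex

sgn : Bool → ℤ
sgn true  = + 1
sgn false = - + 1

value : Partial → Lit → ℤ
value e p = sgn (pos p) * toℤ (e (var p))

-- 4 · Pr[clause satisfied] when its literals have values a and b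
sc : ℤ → ℤ → ℤ
sc a b = + 3 + ((a + b) - a * b)

score : Partial → Clause → ℤ
score e C = sc (value e (fst C)) (value e (snd C))

-- four times the expected number of satisfied clauses
Score : Partial → Formula → ℤ
Score e []      = + 0
Score e (C ∷ F) = score e C + Score e F

Score-cong : ∀ {e e′} → (∀ x → e x ≡ e′ x) → ∀ F → Score e F ≡ Score e′ F
Score-cong {e} {e′} e≗e′ []      = refl
Score-cong {e} {e′} e≗e′ (C ∷ F) =
  cong₂ _+_ (cong₂ sc (value-cong (fst C)) (value-cong (snd C))) (Score-cong e≗e′ F)
  where
  value-cong : ∀ p → value e p ≡ value e′ p
  value-cong p = cong (λ t → sgn (pos p) * toℤ t) (e≗e′ (var p))

-- 1. The score is affine in each variable

value-upd-here : ∀ e v t p → var p ≡ v → value (upd e v t) p ≡ sgn (pos p) * toℤ t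
value-upd-here e v t p p≡v = cong (λ u → sgn (pos p) * toℤ u) (upd-here e v t p≡v)

value-upd-away : ∀ e v t p → var p ≢ v → value (upd e v t) p ≡ value e p
value-upd-away e v t p p≢v = cong (λ u → sgn (pos p) * toℤ u) (upd-away e v t p≢v)

-- sc is affine in each argument (values ±s average to the value 0).
sc-affineˡ : ∀ s b → sc (s * + 1) b + sc (s * - + 1) b ≡ + 2 * sc (s * + 0) b
sc-affineˡ = expanded
  where
  expanded : ∀ s b → (+ 3 + ((s * + 1 + b) - s * + 1 * b)) + (+ 3 + ((s * - + 1 + b) - s * - + 1 * b))
                   ≡ + 2 * (+ 3 + ((s * + 0 + b) - s * + 0 * b))
  expanded = solve-∀

sc-affineʳ : ∀ a s → sc a (s * + 1) + sc a (s * - + 1) ≡ + 2 * sc a (s * + 0)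
sc-affineʳ = expanded
  where
  expanded : ∀ a s → (+ 3 + ((a + s * + 1) - a * (s * + 1))) + (+ 3 + ((a + s * - + 1) - a * (s * - + 1)))
                   ≡ + 2 * (+ 3 + ((a + s * + 0) - a * (s * + 0)))
  expanded = solve-∀

double : ∀ a → a + a ≡ + 2 * a
double = solve-∀

-- A clause has at most one literal on v, so its score is affine in v.
score-affine : ∀ e v C →
  score (upd e v plus) C + score (upd e v minus) C ≡ + 2 * score (upd e v unset) C
score-affine e v C@(cl p q p≢q) = by-cases (var p ≟ v) (var q ≟ v)
  where
  via : (f g : Val → ℤ) →
        (∀ t → value (upd e v t) p ≡ f t) → (∀ t → value (upd e v t) q ≡ g t) →
        sc (f plus) (g plus) + sc (f minus) (g minus) ≡ + 2 * sc (f unset) (g unset) →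
        score (upd e v plus) C + score (upd e v minus) C ≡ + 2 * score (upd e v unset) C
  via f g value-p value-q affine = begin
    score (upd e v plus) C + score (upd e v minus) C
      ≡⟨ cong₂ _+_ (cong₂ sc (value-p plus) (value-q plus)) (cong₂ sc (value-p minus) (value-q minus)) ⟩
    sc (f plus) (g plus) + sc (f minus) (g minus)
      ≡⟨ affine ⟩
    + 2 * sc (f unset) (g unset)
      ≡⟨ cong (_*_ (+ 2)) (cong₂ sc (value-p unset) (value-q unset)) ⟨
    + 2 * score (upd e v unset) C ∎
    where open ≡-Reasoning

  by-cases : Dec (var p ≡ v) → Dec (var q ≡ v) →
    score (upd e v plus) C + score (upd e v minus) C ≡ + 2 * score (upd e v unset) C
  by-cases (yes p≡v) (yes q≡v) = ⊥-elim (p≢q (trans p≡v (sym q≡v)))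
  by-cases (yes p≡v) (no  q≢v) =
    via (λ t → sgn (pos p) * toℤ t) (λ _ → value e q)
        (λ t → value-upd-here e v t p p≡v) (λ t → value-upd-away e v t q q≢v)
        (sc-affineˡ (sgn (pos p)) (value e q))
  by-cases (no  p≢v) (yes q≡v) =
    via (λ _ → value e p) (λ t → sgn (pos q) * toℤ t)
        (λ t → value-upd-away e v t p p≢v) (λ t → value-upd-here e v t q q≡v)
        (sc-affineʳ (value e p) (sgn (pos q)))
  by-cases (no  p≢v) (no  q≢v) =
    via (λ _ → value e p) (λ _ → value e q)
        (λ t → value-upd-away e v t p p≢v) (λ t → value-upd-away e v t q q≢v)
        (double (sc (value e p) (value e q)))

Score-affine : ∀ e v F →
  Score (upd e v plus) F + Score (upd e v minus) F ≡ + 2 * Score (upd e v unset) F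
Score-affine e v []      = refl
Score-affine e v (C ∷ F) = begin
  (score e₊ C + Score e₊ F) + (score e₋ C + Score e₋ F)
    ≡⟨ interchange (score e₊ C) (Score e₊ F) (score e₋ C) (Score e₋ F) ⟩
  (score e₊ C + score e₋ C) + (Score e₊ F + Score e₋ F)
    ≡⟨ cong₂ _+_ (score-affine e v C) (Score-affine e v F) ⟩
  + 2 * score e₀ C + + 2 * Score e₀ F
    ≡⟨ ℤP.*-distribˡ-+ (+ 2) (score e₀ C) (Score e₀ F) ⟨
  + 2 * (score e₀ C + Score e₀ F) ∎
  where
  open ≡-Reasoning
  e₊ = upd e v plus
  e₋ = upd e v minus
  e₀ = upd e v unset

average-below : ∀ {a b s m} → a + b ≡ + 2 * s → a ≤ m → b ≤ m → s ≤ m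
average-below {a} {b} {s} {m} a+b≡2s a≤m b≤m =
  ℤP.*-cancelˡ-≤-pos s m (+ 2) (begin
    + 2 * s ≡⟨ a+b≡2s ⟨
    a + b   ≤⟨ ℤP.+-mono-≤ a≤m b≤m ⟩
    m + m   ≡⟨ double m ⟩
    + 2 * m ∎)
  where open ℤP.≤-Reasoning

best : Formula → Partial → ℕ → Val
best F e v with Score (upd e v minus) F ℤP.≤? Score (upd e v plus) F
... | yes _ = plus
... | no  _ = minus

fix : Formula → Partial → ℕ → Partial
fix F e v = upd e v (best F e v)

best-fixed : ∀ F e v → Fixed (best F e v)
best-fixed F e v with Score (upd e v minus) F ℤP.≤? Score (upd e v plus) F
... | yes _ = λ ()
... | no  _ = λ ()

fix-dominates : ∀ F e v →
  Score (upd e v plus) F ≤ Score (fix F e v) F × Score (upd e v minus) F ≤ Score (fix F e v) F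
fix-dominates F e v with Score (upd e v minus) F ℤP.≤? Score (upd e v plus) F
... | yes m≤p = ℤP.≤-refl , m≤p
... | no  m≰p = ℤP.<⇒≤ (ℤP.≰⇒> m≰p) , ℤP.≤-refl

-- Every value of v, including 0 (by affinity), scores at most fix.
upd-below-fix : ∀ F e v t → Score (upd e v t) F ≤ Score (fix F e v) F
upd-below-fix F e v plus  = proj₁ (fix-dominates F e v)
upd-below-fix F e v minus = proj₂ (fix-dominates F e v)
upd-below-fix F e v unset =
  average-below (Score-affine e v F) (proj₁ (fix-dominates F e v)) (proj₂ (fix-dominates F e v))

fix-improves : ∀ F e v → Score e F ≤ Score (fix F e v) F
fix-improves F e v =
  subst (_≤ Score (fix F e v) F) (Score-cong (upd-self e v) F) (upd-below-fix F e v (e v))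

fix-fixes : ∀ F e v → Fixed (fix F e v v)
fix-fixes F e v = subst Fixed (sym (upd-here e v (best F e v) refl)) (best-fixed F e v)

fix-keeps : ∀ F e v x → Fixed (e x) → Fixed (fix F e v x)
fix-keeps F e v x = upd-keeps-fixed e v (best F e v) x (best-fixed F e v)

-- 2. Fixing all variables of F

ClauseFixed : Partial → Clause → Set
ClauseFixed e C = Fixed (e (var (fst C))) × Fixed (e (var (snd C)))

fixClause : Formula → Partial → Clause → Partial
fixClause F e C = fix F (fix F e (var (fst C))) (var (snd C))

fixClause-fixes : ∀ F e C → ClauseFixed (fixClause F e C) C
fixClause-fixes F e C =
  fix-keeps F _ (var (snd C)) (var (fst C)) (fix-fixes F e (var (fst C))) ,
  fix-fixes F _ (var (snd C))

fixClause-keeps : ∀ F e C x → Fixed (e x) → Fixed (fixClause F e C x)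
fixClause-keeps F e C x fixed =
  fix-keeps F _ (var (snd C)) x (fix-keeps F e (var (fst C)) x fixed)

fixClause-improves : ∀ F e C → Score e F ≤ Score (fixClause F e C) F
fixClause-improves F e C =
  ℤP.≤-trans (fix-improves F e (var (fst C))) (fix-improves F _ (var (snd C)))

fixAll : Formula → Partial → Formula → Partial
fixAll F e []      = e
fixAll F e (C ∷ G) = fixAll F (fixClause F e C) G

fixAll-keeps : ∀ F e G x → Fixed (e x) → Fixed (fixAll F e G x)
fixAll-keeps F e []      x fixed = fixed
fixAll-keeps F e (C ∷ G) x fixed = fixAll-keeps F _ G x (fixClause-keeps F e C x fixed)

fixAll-fixes : ∀ F e G → All (ClauseFixed (fixAll F e G)) G
fixAll-fixes F e []      = []
fixAll-fixes F e (C ∷ G) =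
  (fixAll-keeps F e′ G _ (proj₁ (fixClause-fixes F e C)) ,
   fixAll-keeps F e′ G _ (proj₂ (fixClause-fixes F e C))) ∷ fixAll-fixes F e′ G
  where e′ = fixClause F e C

fixAll-improves : ∀ F e G → Score e F ≤ Score (fixAll F e G) F
fixAll-improves F e []      = ℤP.≤-refl
fixAll-improves F e (C ∷ G) = ℤP.≤-trans (fixClause-improves F e C) (fixAll-improves F _ G)

isPlus : Val → Bool
isPlus plus = true
isPlus _    = false

assignment : Partial → Assignment
assignment e x = isPlus (e x)

toℤ-fixed : ∀ t → Fixed t → toℤ t ≡ sgn (isPlus t)
toℤ-fixed plus  _     = refl
toℤ-fixed minus _     = refl
toℤ-fixed unset fixed = ⊥-elim (fixed refl)

value-fixed : ∀ e p → Fixed (e (var p)) → value e p ≡ sgn (litVal (assignment e) p)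
value-fixed e (lit x true)  fixed = trans (ℤP.*-identityˡ _) (toℤ-fixed (e x) fixed)
value-fixed e (lit x false) fixed = trans (cong (- + 1 *_) (toℤ-fixed (e x) fixed)) (negate (isPlus (e x)))
  where
  negate : ∀ a → - + 1 * sgn a ≡ sgn (not a)
  negate true  = refl
  negate false = refl

sc-sgn : ∀ a b → sc (sgn a) (sgn b) ≡ + (if a ∨ b then 4 else 0)
sc-sgn true  true  = refl
sc-sgn true  false = refl
sc-sgn false true  = refl
sc-sgn false false = refl

score-fixed : ∀ e C → ClauseFixed e C → score e C ≡ + (if satisfies (assignment e) C then 4 else 0)
score-fixed e C (fixed₁ , fixed₂) =
  trans (cong₂ sc (value-fixed e (fst C) fixed₁) (value-fixed e (snd C) fixed₂))
        (sc-sgn (litVal (assignment e) (fst C)) (litVal (assignment e) (snd C)))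

count-step : ∀ b n → + (if b then 4 else 0) + + (4 *ℕ n) ≡ + (4 *ℕ (if b then suc n else n))
count-step true  n = trans (sym (ℤP.pos-+ 4 (4 *ℕ n))) (cong +_ (sym (*-suc 4 n)))
count-step false n = refl

Score-fixed : ∀ e F → All (ClauseFixed e) F → Score e F ≡ + (4 *ℕ numSat F (assignment e))
Score-fixed e []      []             = refl
Score-fixed e (C ∷ F) (fixed ∷ rest) =
  trans (cong₂ _+_ (score-fixed e C fixed) (Score-fixed e F rest))
        (count-step (satisfies (assignment e) C) (numSat F (assignment e)))

-- 3. The starting assignment has score 3m + k_R

ind : Bool → ℤ
ind b = + (if b then 1 else 0)

exclusive : ∀ a b → (a ≡ true → b ≡ true → ⊥) → a ∧ b ≡ false
exclusive true  true  not-both = ⊥-elim (not-both refl refl)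
exclusive true  false not-both = refl
exclusive false b     not-both = refl

ind-∨ : ∀ a b → a ∧ b ≡ false → ind (a ∨ b) ≡ ind a + ind b
ind-∨ true  true  ()
ind-∨ true  false _ = refl
ind-∨ false true  _ = refl
ind-∨ false false _ = refl

ind-∧ : ∀ a b → ind (a ∧ b) ≡ ind a * ind b
ind-∧ true  true  = refl
ind-∧ true  false = refl
ind-∧ false true  = refl
ind-∧ false false = refl

≡ᵇ-true : ∀ {m n} → m ≡ n → (m ≡ᵇ n) ≡ true
≡ᵇ-true {m} {n} m≡n = Equivalence.to T-≡ (≡⇒≡ᵇ m n m≡n)

≡ᵇ-false : ∀ {m n} → m ≢ n → (m ≡ᵇ n) ≡ false
≡ᵇ-false {m} {n} m≢n with m ≡ᵇ n in eq
... | true  = ⊥-elim (m≢n (≡ᵇ⇒≡ m n (Equivalence.from T-≡ eq)))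
... | false = refl

≟ᴸ-var : ∀ p r → (p ≟ᴸ r) ≡ true → var p ≡ var r
≟ᴸ-var (lit a s) (lit b t) eq =
  ≡ᵇ⇒≡ a b (Equivalence.from T-≡ (∧-conicalˡ (a ≡ᵇ b) (s =ᵇ t) eq))

-- δ p x ∈ {1, -1, 0} records whether p is x, x̄, or neither; D p R = Σ_{x ∈ R} δ p x
-- is the value of p under the assignment that is +1 on R.
δ : Lit → ℕ → ℤ
δ p x = ind (p ≟ᴸ pl x) - ind (p ≟ᴸ nl x)

D : Lit → List ℕ → ℤ
D p []       = + 0
D p (x ∷ xs) = δ p x + D p xs

δ-here : ∀ p x → var p ≡ x → δ p x ≡ sgn (pos p)
δ-here (lit a true)  x a≡x rewrite ≡ᵇ-true a≡x = refl
δ-here (lit a false) x a≡x rewrite ≡ᵇ-true a≡x = refl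

δ-away : ∀ p x → var p ≢ x → δ p x ≡ + 0
δ-away (lit a s) x a≢x rewrite ≡ᵇ-false a≢x = refl

D-away : ∀ p xs → All (var p ≢_) xs → D p xs ≡ + 0
D-away p []       []            = refl
D-away p (x ∷ xs) (p≢x ∷ p≢xs) =
  trans (cong₂ _+_ (δ-away p x p≢x) (D-away p xs p≢xs)) refl

δ-exclusive : ∀ p q x → var p ≢ var q → δ p x * δ q x ≡ + 0
δ-exclusive p q x p≢q with var p ≟ x
... | yes p≡x = trans (cong (δ p x *_) (δ-away q x (λ q≡x → p≢q (trans p≡x (sym q≡x)))))
                      (ℤP.*-zeroʳ (δ p x))
... | no  p≢x = cong (_* δ q x) (δ-away p x p≢x)

module SingleClause (C : Clause) where
  private
    p = fst C
    q = snd C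

    not-both : ∀ {r} → (p ≟ᴸ r) ≡ true → (q ≟ᴸ r) ≡ true → ⊥
    not-both {r} p≡r q≡r = distinct C (trans (≟ᴸ-var p r p≡r) (sym (≟ᴸ-var q r q≡r)))

  c₁-single : ∀ r → + c₁ (C ∷ []) r ≡ ind (p ≟ᴸ r) + ind (q ≟ᴸ r)
  c₁-single r = ind-∨ (p ≟ᴸ r) (q ≟ᴸ r) (exclusive (p ≟ᴸ r) (q ≟ᴸ r) not-both)

  c₂-single : ∀ r t →
    + c₂ (C ∷ []) r t ≡ ind (p ≟ᴸ r) * ind (q ≟ᴸ t) + ind (p ≟ᴸ t) * ind (q ≟ᴸ r)
  c₂-single r t = begin
    ind (((p ≟ᴸ r) ∧ (q ≟ᴸ t)) ∨ ((p ≟ᴸ t) ∧ (q ≟ᴸ r)))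
      ≡⟨ ind-∨ pr-qt pt-qr (exclusive pr-qt pt-qr (λ h₁ h₂ → not-both (∧-conicalˡ (p ≟ᴸ r) (q ≟ᴸ t) h₁) (∧-conicalʳ (p ≟ᴸ t) (q ≟ᴸ r) h₂))) ⟩
    ind ((p ≟ᴸ r) ∧ (q ≟ᴸ t)) + ind ((p ≟ᴸ t) ∧ (q ≟ᴸ r))
      ≡⟨ cong₂ _+_ (ind-∧ (p ≟ᴸ r) (q ≟ᴸ t)) (ind-∧ (p ≟ᴸ t) (q ≟ᴸ r)) ⟩
    ind (p ≟ᴸ r) * ind (q ≟ᴸ t) + ind (p ≟ᴸ t) * ind (q ≟ᴸ r) ∎
    where
    open ≡-Reasoning
    pr-qt = (p ≟ᴸ r) ∧ (q ≟ᴸ t)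
    pt-qr = (p ≟ᴸ t) ∧ (q ≟ᴸ r)

  sum₁-single : ∀ R → sum₁ (C ∷ []) R ≡ D p R + D q R
  sum₁-single []       = refl
  sum₁-single (x ∷ xs) = begin
    (+ c₁ (C ∷ []) (pl x) - + c₁ (C ∷ []) (nl x)) + sum₁ (C ∷ []) xs
      ≡⟨ cong₂ _+_ (cong₂ _-_ (c₁-single (pl x)) (c₁-single (nl x))) (sum₁-single xs) ⟩
    ((ind (p ≟ᴸ pl x) + ind (q ≟ᴸ pl x)) - (ind (p ≟ᴸ nl x) + ind (q ≟ᴸ nl x))) + (D p xs + D q xs)
      ≡⟨ regroup (ind (p ≟ᴸ pl x)) (ind (q ≟ᴸ pl x)) (ind (p ≟ᴸ nl x)) (ind (q ≟ᴸ nl x)) (D p xs) (D q xs) ⟩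
    (δ p x + D p xs) + (δ q x + D q xs) ∎
    where
    open ≡-Reasoning
    regroup : ∀ a b c d u w → ((a + b) - (c + d)) + (u + w) ≡ ((a - c) + u) + ((b - d) + w)
    regroup = solve-∀

  pairTerm-single : ∀ x y → pairTerm (C ∷ []) x y ≡ - (δ p x * δ q y + δ p y * δ q x)
  pairTerm-single x y =
    trans (cong₂ _-_ (cong₂ _+_ (c₂-single (pl x) (nl y)) (c₂-single (nl x) (pl y)))
                     (cong₂ _+_ (c₂-single (pl x) (pl y)) (c₂-single (nl x) (nl y))))
    (expand (ind (p ≟ᴸ pl x)) (ind (p ≟ᴸ nl x)) (ind (p ≟ᴸ pl y)) (ind (p ≟ᴸ nl y))
             (ind (q ≟ᴸ pl x)) (ind (q ≟ᴸ nl x)) (ind (q ≟ᴸ pl y)) (ind (q ≟ᴸ nl y)))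
    where
    expand : ∀ a⁺ a⁻ b⁺ b⁻ c⁺ c⁻ d⁺ d⁻ →
      ((a⁺ * d⁻ + b⁻ * c⁺) + (a⁻ * d⁺ + b⁺ * c⁻)) - ((a⁺ * d⁺ + b⁺ * c⁺) + (a⁻ * d⁻ + b⁻ * c⁻))
        ≡ - ((a⁺ - a⁻) * (d⁺ - d⁻) + (b⁺ - b⁻) * (c⁺ - c⁻))
    expand = solve-∀

  sumWith-single : ∀ x ys → sumWith (C ∷ []) x ys ≡ - (δ p x * D q ys + δ q x * D p ys)
  sumWith-single x []       = solve-zero (δ p x) (δ q x)
    where
    solve-zero : ∀ u v → + 0 ≡ - (u * + 0 + v * + 0)
    solve-zero = solve-∀
  sumWith-single x (y ∷ ys) =
    trans (cong₂ _+_ (pairTerm-single x y) (sumWith-single x ys))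
          (collect (δ p x) (δ q x) (δ q y) (δ p y) (D q ys) (D p ys))
    where
    collect : ∀ u v c e Dq Dp → - (u * c + e * v) + - (u * Dq + v * Dp) ≡ - (u * (c + Dq) + v * (e + Dp))
    collect = solve-∀

  sum₂-single : ∀ R → sum₂ (C ∷ []) R ≡ - (D p R * D q R)
  sum₂-single []       = refl
  sum₂-single (x ∷ xs) = begin
    sumWith (C ∷ []) x xs + sum₂ (C ∷ []) xs
      ≡⟨ cong₂ _+_ (sumWith-single x xs) (sum₂-single xs) ⟩
    - (u * Dq + v * Dp) + - (Dp * Dq)
      ≡⟨ ℤP.+-identityʳ _ ⟨
    - (u * Dq + v * Dp) + - (Dp * Dq) - + 0
      ≡⟨ cong (λ z → - (u * Dq + v * Dp) + - (Dp * Dq) - z) (δ-exclusive p q x (distinct C)) ⟨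
    - (u * Dq + v * Dp) + - (Dp * Dq) - u * v
      ≡⟨ collect u v Dp Dq ⟩
    - ((u + Dp) * (v + Dq)) ∎
    where
    open ≡-Reasoning
    u = δ p x
    v = δ q x
    Dp = D p xs
    Dq = D q xs
    collect : ∀ u v Dp Dq → - (u * Dq + v * Dp) + - (Dp * Dq) - u * v ≡ - ((u + Dp) * (v + Dq))
    collect = solve-∀

  kR-single : ∀ R → kR (C ∷ []) R ≡ (D p R + D q R) - D p R * D q R
  kR-single R = cong₂ _+_ (sum₁-single R) (sum₂-single R)

-- k_R is additive over the clauses of F: the counts c₁, c₂ are, and
-- additivity is preserved by sums and differences.
Additive : (Formula → ℤ) → Set
Additive Φ = ∀ C F → Φ (C ∷ F) ≡ Φ (C ∷ []) + Φ F

+-additive : ∀ Φ Ψ → Additive Φ → Additive Ψ → Additive (λ F → Φ F + Ψ F)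
+-additive Φ Ψ Φ-add Ψ-add C F =
  trans (cong₂ _+_ (Φ-add C F) (Ψ-add C F)) (interchange (Φ (C ∷ [])) (Φ F) (Ψ (C ∷ [])) (Ψ F))

-additive : ∀ Φ Ψ → Additive Φ → Additive Ψ → Additive (λ F → Φ F - Ψ F)
-additive Φ Ψ Φ-add Ψ-add C F =
  trans (cong₂ _-_ (Φ-add C F) (Ψ-add C F)) (regroup (Φ (C ∷ [])) (Φ F) (Ψ (C ∷ [])) (Ψ F))
  where
  regroup : ∀ a′ a″ b′ b″ → (a′ + a″) - (b′ + b″) ≡ (a′ - b′) + (a″ - b″)
  regroup = solve-∀

c₁-additive : ∀ r → Additive (λ F → + c₁ F r)
c₁-additive r C F with containsᵇ C r
... | true  = refl
... | false = refl

c₂-additive : ∀ r t → Additive (λ F → + c₂ F r t)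
c₂-additive r t C F with isClauseᵇ C r t
... | true  = refl
... | false = refl

sum₁-additive : ∀ R → Additive (λ F → sum₁ F R)
sum₁-additive []       C F = refl
sum₁-additive (x ∷ xs) =
  +-additive (λ F → + c₁ F (pl x) - + c₁ F (nl x)) (λ F → sum₁ F xs)
    (-additive (λ F → + c₁ F (pl x)) (λ F → + c₁ F (nl x)) (c₁-additive (pl x)) (c₁-additive (nl x)))
    (sum₁-additive xs)

pairTerm-additive : ∀ x y → Additive (λ F → pairTerm F x y)
pairTerm-additive x y =
  -additive (λ F → + c₂ F (pl x) (nl y) + + c₂ F (nl x) (pl y))
            (λ F → + c₂ F (pl x) (pl y) + + c₂ F (nl x) (nl y))
    (+-additive (λ F → + c₂ F (pl x) (nl y)) (λ F → + c₂ F (nl x) (pl y))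
                (c₂-additive (pl x) (nl y)) (c₂-additive (nl x) (pl y)))
    (+-additive (λ F → + c₂ F (pl x) (pl y)) (λ F → + c₂ F (nl x) (nl y))
                (c₂-additive (pl x) (pl y)) (c₂-additive (nl x) (nl y)))

sumWith-additive : ∀ x ys → Additive (λ F → sumWith F x ys)
sumWith-additive x []       C F = refl
sumWith-additive x (y ∷ ys) =
  +-additive (λ F → pairTerm F x y) (λ F → sumWith F x ys)
    (pairTerm-additive x y) (sumWith-additive x ys)

sum₂-additive : ∀ R → Additive (λ F → sum₂ F R)
sum₂-additive []       C F = refl
sum₂-additive (x ∷ xs) =
  +-additive (λ F → sumWith F x xs) (λ F → sum₂ F xs) (sumWith-additive x xs) (sum₂-additive xs)

kR-additive : ∀ R → Additive (λ F → kR F R)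
kR-additive R =
  +-additive (λ F → sum₁ F R) (λ F → sum₂ F R) (sum₁-additive R) (sum₂-additive R)

kR-nil : ∀ R → kR [] R ≡ + 0
kR-nil R = cong₂ _+_ (sum₁-nil R) (sum₂-nil R)
  where
  sum₁-nil : ∀ xs → sum₁ [] xs ≡ + 0
  sum₁-nil []       = refl
  sum₁-nil (x ∷ xs) = trans (ℤP.+-identityˡ (sum₁ [] xs)) (sum₁-nil xs)
  sumWith-nil : ∀ x ys → sumWith [] x ys ≡ + 0
  sumWith-nil x []       = refl
  sumWith-nil x (y ∷ ys) = trans (ℤP.+-identityˡ (sumWith [] x ys)) (sumWith-nil x ys)
  sum₂-nil : ∀ xs → sum₂ [] xs ≡ + 0
  sum₂-nil []       = refl
  sum₂-nil (x ∷ xs) = cong₂ _+_ (sumWith-nil x xs) (sum₂-nil xs)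

initial : List ℕ → Partial
initial []       x = unset
initial (y ∷ ys) = upd (initial ys) y plus

value-initial : ∀ R p → Unique R → value (initial R) p ≡ D p R
value-initial []       p []              = ℤP.*-zeroʳ (sgn (pos p))
value-initial (x ∷ xs) p (x∉xs ∷ unique) = by-cases (var p ≟ x)
  where
  open ≡-Reasoning
  by-cases : Dec (var p ≡ x) → value (upd (initial xs) x plus) p ≡ δ p x + D p xs
  by-cases (yes p≡x) = begin
    value (upd (initial xs) x plus) p ≡⟨ value-upd-here (initial xs) x plus p p≡x ⟩
    sgn (pos p) * + 1                 ≡⟨ ℤP.*-identityʳ (sgn (pos p)) ⟩
    sgn (pos p)                       ≡⟨ ℤP.+-identityʳ (sgn (pos p)) ⟨
    sgn (pos p) + + 0                 ≡⟨ cong₂ _+_ (δ-here p x p≡x) p-absent ⟨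
    δ p x + D p xs                    ∎
    where
    p-absent : D p xs ≡ + 0
    p-absent = D-away p xs (subst (λ z → All (z ≢_) xs) (sym p≡x) x∉xs)
  by-cases (no p≢x) = begin
    value (upd (initial xs) x plus) p ≡⟨ value-upd-away (initial xs) x plus p p≢x ⟩
    value (initial xs) p              ≡⟨ value-initial xs p unique ⟩
    D p xs                            ≡⟨ ℤP.+-identityˡ (D p xs) ⟨
    + 0 + D p xs                      ≡⟨ cong (_+ D p xs) (δ-away p x p≢x) ⟨
    δ p x + D p xs                    ∎

Score-initial : ∀ R → Unique R → ∀ F → Score (initial R) F ≡ + 3 * + length F + kR F R
Score-initial R unique []      = sym (trans (ℤP.+-identityˡ (kR [] R)) (kR-nil R))
Score-initial R unique (C ∷ F) = begin
  score (initial R) C + Score (initial R) F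
    ≡⟨ cong₂ _+_ clause-score (Score-initial R unique F) ⟩
  (+ 3 + kR (C ∷ []) R) + (+ 3 * + length F + kR F R)
    ≡⟨ regroup (kR (C ∷ []) R) (+ length F) (kR F R) ⟩
  + 3 * (+ 1 + + length F) + (kR (C ∷ []) R + kR F R)
    ≡⟨ cong (_+_ (+ 3 * + length (C ∷ F))) (kR-additive R C F) ⟨
  + 3 * + length (C ∷ F) + kR (C ∷ F) R ∎
  where
  open ≡-Reasoning
  clause-score : score (initial R) C ≡ + 3 + kR (C ∷ []) R
  clause-score = trans (cong₂ sc (value-initial R (fst C) unique) (value-initial R (snd C) unique))
                       (cong (_+_ (+ 3)) (sym (SingleClause.kR-single C R)))
  regroup : ∀ k n K → (+ 3 + k) + (+ 3 * n + K) ≡ + 3 * (+ 1 + n) + (k + K)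
  regroup = solve-∀

lemma5p4 : (F : Formula) → ¬ HasSemicompleteSub F →
           (R : List ℕ) → Unique R → All (λ x → x ∈var F) R →
           ∃ λ (α : Assignment) → (+ 3) * (+ length F) + kR F R ≤ (+ 4) * (+ numSat F α)
lemma5p4 F _ R unique _ = assignment final , (begin
  + 3 * + length F + kR F R          ≡⟨ Score-initial R unique F ⟨
  Score (initial R) F                ≤⟨ fixAll-improves F (initial R) F ⟩
  Score final F                      ≡⟨ Score-fixed final F (fixAll-fixes F (initial R) F) ⟩
  + (4 *ℕ numSat F (assignment final)) ≡⟨ ℤP.pos-* 4 (numSat F (assignment final)) ⟩
  + 4 * + numSat F (assignment final) ∎)
  where
  open ℤP.≤-Reasoning
  final : Partial
  final = fixAll F (initial R) F
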